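{- Let $k\ge 2$ and let $u_i$ be an outer vertex and $v_j$ an inner vertex of $GP(2k+1,2)$ with $r=|i-j|\le k$. Then the number $\sigma(u_i,v_j)$ of geodesics between $u_i$ and $v_j$ is $$\sigma(u_i,v_j)=\begin{cases}1 & r<k,\\ 1 & r \text{ even},\ r=k,\\ 2 & r\text{ odd},\ r=k.\end{cases}$$
   Context: For an integer $n\ge 5$, $GP(n,2)$ is the graph with vertex set $\{u_0,\dots,u_{n-1},v_0,\dots,v_{n-1}\}$ and edges $u_iu_{i+1}$ (outer edges), $u_iv_i$ (spokes) and $v_iv_{i+2}$ (inner edges) for $0\le i\le n-1$, subscripts modulo $n$. The $u_i$ are outer vertices, the $v_i$ inner vertices. A geodesic is a shortest path; $\sigma(x,y)$ denotes the number of geodesics between $x$ and $y$. -}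

module Defs where

open import Data.Nat using (ℕ; zero; suc; _+_; _≤_; NonZero)
open import Data.Nat.DivMod using (_%_)
open import Data.Fin using (Fin; toℕ)
open import Data.List using (List; []; _∷_; length)
open import Data.List.Membership.Propositional using (_∈_)
open import Data.List.Relation.Unary.Unique.Propositional using (Unique)
open import Data.Product using (Σ; _×_)
open import Data.Sum using (_⊎_)
open import Function.Bundles using (_⇔_)
open import Relation.Binary.PropositionalEquality using (_≡_)

-- Vertices of GP(n,2): outer i = u_i, inner i = v_i.
data Vertex (n : ℕ) : Set where
  outer : Fin n → Vertex n
  inner : Fin n → Vertex n

Adj : (n : ℕ) → .{{_ : NonZero n}} → Vertex n → Vertex n → Set
Adj n (outer i) (outer j) = (toℕ j ≡ (toℕ i + 1) % n) ⊎ (toℕ i ≡ (toℕ j + 1) % n)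
Adj n (outer i) (inner j) = i ≡ j
Adj n (inner i) (outer j) = i ≡ j
Adj n (inner i) (inner j) = (toℕ j ≡ (toℕ i + 2) % n) ⊎ (toℕ i ≡ (toℕ j + 2) % n)

data Walk (n : ℕ) .{{_ : NonZero n}} : Vertex n → Vertex n → List (Vertex n) → Set where
  here  : ∀ {x} → Walk n x x (x ∷ [])
  step  : ∀ {x z y p} → Adj n x z → Walk n z y p → Walk n x y (x ∷ p)

IsPath : (n : ℕ) → .{{_ : NonZero n}} → Vertex n → Vertex n → List (Vertex n) → Set
IsPath n x y p = Walk n x y p × Unique p

IsGeodesic : (n : ℕ) → .{{_ : NonZero n}} → Vertex n → Vertex n → List (Vertex n) → Set
IsGeodesic n x y p = IsPath n x y p × (∀ q → IsPath n x y q → length p ≤ length q)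

σ≡ : (n : ℕ) → .{{_ : NonZero n}} → Vertex n → Vertex n → ℕ → Set
σ≡ n x y c = Σ (List (List (Vertex n))) λ L →
  Unique L × (∀ p → (p ∈ L) ⇔ IsGeodesic n x y p) × (length L ≡ c)

module Submission where

-- Let c(a) be the distance from a to 0 around the n-cycle and put pot(v_a) = ⌈c(a)/2⌉,
-- pot(u_a) = 1 + ⌈c(a)/2⌉. This changes by at most one along every edge and vanishes at v₀, so
-- every walk from x to v₀ has at least pot(x) + 1 vertices. For r ≤ k explicit walks from u_r attain
-- the bound, hence the geodesics from u_r are exactly the walks that decrease pot at every step.
-- Listing the downhill neighbours of each vertex leaves a single such walk (the spoke at u_r for even
-- r, the edge u_r u_{r-1} and the spoke at u_{r-1} for odd r, then down the inner cycle in steps of 2),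
-- except when r = k is odd: then v_k also descends to v_{k+2}, and the inner cycle continues from
-- there through v_{n-2} to v₀.
-- Rotations and a reflection of GP(n,2) carry any pair (u_i, v_j) to (u_r, v₀) with r = |i - j|.

open import Data.Empty using (⊥-elim)
open import Data.Fin using (Fin; toℕ; zero; fromℕ<)
open import Data.Fin.Properties using (toℕ<n; toℕ-fromℕ<; toℕ-injective)
open import Data.List using (List; []; _∷_; length; map)
open import Data.List.Membership.Propositional using (_∈_)
open import Data.List.Membership.Propositional.Properties using (∈-map⁺; ∈-map⁻)
open import Data.List.Properties using (length-map; map-∘; map-id; map-cong)
open import Data.List.Relation.Unary.All as All using (All; []; _∷_)
open import Data.List.Relation.Unary.AllPairs using ([]; _∷_)
open import Data.List.Relation.Unary.Any using (here; there)
open import Data.List.Relation.Unary.Unique.Propositional using (Unique)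
import Data.List.Relation.Unary.Unique.Propositional.Properties as Unique
open import Data.Nat
open import Data.Nat.DivMod
open import Data.Nat.Divisibility using (_∣_; divides; ∣m+n∣m⇒∣n; ∣⇒≤)
open import Data.Nat.Properties
open import Data.Nat.Tactic.RingSolver using (solve-∀)
open import Data.Product using (Σ; ∃; _×_; _,_; proj₁; proj₂)
open import Data.Sum using (_⊎_; inj₁; inj₂)
open import Function using (_∘_)
open import Function.Bundles using (mk⇔; Equivalence)
open import Relation.Nullary using (¬_; yes; no)
open import Relation.Binary.PropositionalEquality

open import Defs

≤-by : ∀ {x y} d → x + d ≡ y → x ≤ y
≤-by {x} d refl = m≤m+n x d

module Cycle (m : ℕ) where

  n : ℕ
  n = suc m

  fin : ℕ → Fin n
  fin x = fromℕ< (m%n<n x n)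

  toℕ-fin : ∀ x → toℕ (fin x) ≡ x % n
  toℕ-fin x = toℕ-fromℕ< (m%n<n x n)

  toℕ-fin< : ∀ {x} → x < n → toℕ (fin x) ≡ x
  toℕ-fin< {x} x<n = trans (toℕ-fin x) (m<n⇒m%n≡m x<n)

  ≡-fin : ∀ {a : Fin n} {x} → toℕ a ≡ x → a ≡ fin x
  ≡-fin {a} refl = toℕ-injective (sym (toℕ-fin< (toℕ<n a)))

  toℕ-fin-% : ∀ x → toℕ (fin x) % n ≡ x % n
  toℕ-fin-% x = trans (cong (_% n) (toℕ-fin x)) (m%n%n≡m%n x n)

  toℕ%n : ∀ (a : Fin n) → toℕ a % n ≡ toℕ a
  toℕ%n a = m<n⇒m%n≡m (toℕ<n a)

  [x%n+y]%n≡[x+y]%n : ∀ x y → (x % n + y) % n ≡ (x + y) % n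
  [x%n+y]%n≡[x+y]%n x y = begin
    (x % n + y) % n           ≡⟨ %-distribˡ-+ (x % n) y n ⟩
    (x % n % n + y % n) % n   ≡⟨ cong (λ z → (z + y % n) % n) (m%n%n≡m%n x n) ⟩
    (x % n + y % n) % n       ≡⟨ %-distribˡ-+ x y n ⟨
    (x + y) % n               ∎
    where open ≡-Reasoning

  toℕ-fin-+ : ∀ x s → toℕ (fin (x + s)) ≡ (toℕ (fin x) + s) % n
  toℕ-fin-+ x s = trans (toℕ-fin (x + s))
    (trans (sym ([x%n+y]%n≡[x+y]%n x s)) (cong (λ z → (z + s) % n) (sym (toℕ-fin x))))

  %-cong-+ˡ : ∀ z {x y} → x % n ≡ y % n → (z + x) % n ≡ (z + y) % n
  %-cong-+ˡ z {x} {y} e = begin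
    (z + x) % n             ≡⟨ %-distribˡ-+ z x n ⟩
    (z % n + x % n) % n     ≡⟨ cong (λ w → (z % n + w) % n) e ⟩
    (z % n + y % n) % n     ≡⟨ %-distribˡ-+ z y n ⟨
    (z + y) % n             ∎
    where open ≡-Reasoning

  %-cong-*ˡ : ∀ z {x y} → x % n ≡ y % n → (z * x) % n ≡ (z * y) % n
  %-cong-*ˡ z {x} {y} e = begin
    (z * x) % n             ≡⟨ %-distribˡ-* z x n ⟩
    (z % n * (x % n)) % n   ≡⟨ cong (λ w → (z % n * w) % n) e ⟩
    (z % n * (y % n)) % n   ≡⟨ %-distribˡ-* z y n ⟨
    (z * y) % n             ∎
    where open ≡-Reasoning

  data Step (a b s : ℕ) : Set where
    forward       : b ≡ a + s → Step a b s
    forward-wrap  : b + n ≡ a + s → Step a b s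
    backward      : a ≡ b + s → Step a b s
    backward-wrap : a + n ≡ b + s → Step a b s

  %-step : ∀ {a b s} → a < n → s ≤ n → b ≡ (a + s) % n → b ≡ a + s ⊎ b + n ≡ a + s
  %-step {a} {b} {s} a<n s≤n refl with a + s <? n
  ... | yes a+s<n = inj₁ (m<n⇒m%n≡m a+s<n)
  ... | no a+s≮n = inj₂ (begin
    (a + s) % n + n             ≡⟨ cong (λ z → z % n + n) (m∸n+n≡m n≤a+s) ⟨
    (a + s ∸ n + n) % n + n     ≡⟨ cong (_+ n) ([m+n]%n≡m%n (a + s ∸ n) n) ⟩
    (a + s ∸ n) % n + n         ≡⟨ cong (_+ n) (m<n⇒m%n≡m a+s∸n<n) ⟩
    a + s ∸ n + n               ≡⟨ m∸n+n≡m n≤a+s ⟩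
    a + s                       ∎)
    where
    open ≡-Reasoning
    n≤a+s : n ≤ a + s
    n≤a+s = ≮⇒≥ a+s≮n
    a+s∸n<n : a + s ∸ n < n
    a+s∸n<n = m<n+o⇒m∸n<o (a + s) n (+-mono-<-≤ a<n s≤n)

  Neighbours : ℕ → Fin n → Fin n → Set
  Neighbours s a b = toℕ b ≡ (toℕ a + s) % n ⊎ toℕ a ≡ (toℕ b + s) % n

  step-cases : ∀ {a b : Fin n} {s} → s ≤ n → Neighbours s a b → Step (toℕ a) (toℕ b) s
  step-cases {a} {b} s≤n (inj₁ e) with %-step (toℕ<n a) s≤n e
  ... | inj₁ e′ = forward e′
  ... | inj₂ e′ = forward-wrap e′
  step-cases {a} {b} s≤n (inj₂ e) with %-step (toℕ<n b) s≤n e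
  ... | inj₁ e′ = backward e′
  ... | inj₂ e′ = backward-wrap e′

  no-forward-wrap : ∀ {a b s} → a + s < n → b + n ≢ a + s
  no-forward-wrap {b = b} lt e = <⇒≱ lt (subst (n ≤_) e (m≤n+m n b))

  no-backward-wrap : ∀ {a b s} → b < n → s ≤ a → a + n ≢ b + s
  no-backward-wrap {a} {b} {s} b<n s≤a e = <⇒≱ (+-mono-<-≤ b<n s≤a)
    (≤-reflexive (trans (+-comm n a) e))

  cdist : ℕ → ℕ
  cdist c = c ⊓ (n ∸ c)

  cdist-≤ : ∀ {a b s} → a ≤ b + s → n ∸ a ≤ n ∸ b + s → cdist a ≤ cdist b + s
  cdist-≤ {a} {b} {s} p q = begin
    a ⊓ (n ∸ a)             ≤⟨ ⊓-mono-≤ p q ⟩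
    (b + s) ⊓ (n ∸ b + s)   ≡⟨ +-distribʳ-⊓ s b (n ∸ b) ⟨
    cdist b + s             ∎
    where open ≤-Reasoning

  cdist-lipschitz : ∀ {a b s} → b ≤ n → Step a b s → cdist a ≤ cdist b + s
  cdist-lipschitz {a} {b} {s} b≤n (forward refl) =
    cdist-≤ {b = b} {s} (≤-trans (m≤m+n a s) (m≤m+n (a + s) s)) (≤-reflexive (begin-equality
      n ∸ a                     ≡⟨ cong (_∸ a) (m+[n∸m]≡n b≤n) ⟨
      a + s + (n ∸ b) ∸ a       ≡⟨ cong (_∸ a) (+-assoc a s (n ∸ b)) ⟩
      a + (s + (n ∸ b)) ∸ a     ≡⟨ m+n∸m≡n a (s + (n ∸ b)) ⟩
      s + (n ∸ b)               ≡⟨ +-comm s (n ∸ b) ⟩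
      n ∸ b + s                 ∎))
    where open ≤-Reasoning
  cdist-lipschitz {a} {b} {s} b≤n (backward refl) =
    cdist-≤ {b = b} {s} ≤-refl (≤-trans (∸-monoʳ-≤ n (m≤m+n b s)) (m≤m+n (n ∸ b) s))
  cdist-lipschitz {a} {b} {s} b≤n (forward-wrap e) = begin
    cdist a       ≤⟨ m⊓n≤n a (n ∸ a) ⟩
    n ∸ a         ≤⟨ m≤n+o⇒m∸n≤o n a (subst (n ≤_) e (m≤n+m n b)) ⟩
    s             ≤⟨ m≤n+m s (cdist b) ⟩
    cdist b + s   ∎
    where open ≤-Reasoning
  cdist-lipschitz {a} {b} {s} b≤n (backward-wrap e) = begin
    cdist a       ≤⟨ m⊓n≤m a (n ∸ a) ⟩
    a             ≤⟨ +-cancelʳ-≤ n a s a+n≤s+n ⟩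
    s             ≤⟨ m≤n+m s (cdist b) ⟩
    cdist b + s   ∎
    where
    open ≤-Reasoning
    a+n≤s+n : a + n ≤ s + n
    a+n≤s+n = begin
      a + n   ≡⟨ e ⟩
      b + s   ≤⟨ +-monoˡ-≤ s b≤n ⟩
      n + s   ≡⟨ +-comm n s ⟩
      s + n   ∎

  cdist-lower : ∀ {l c} → l ≤ c → l + c ≤ n → l ≤ cdist c
  cdist-lower {l} l≤c l+c≤n = ⊓-glb l≤c (m+n≤o⇒m≤o∸n l l+c≤n)

  cdist-small : ∀ {c} → c + c ≤ n → cdist c ≡ c
  cdist-small {c} c+c≤n = m≤n⇒m⊓n≡m (m+n≤o⇒m≤o∸n c c+c≤n)

  cdist-large : ∀ {a c} → a + c ≡ n → c ≤ a → cdist a ≡ c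
  cdist-large {a} {c} e c≤a = begin
    a ⊓ (n ∸ a)         ≡⟨ cong (λ z → a ⊓ (z ∸ a)) e ⟨
    a ⊓ (a + c ∸ a)     ≡⟨ cong (a ⊓_) (m+n∸m≡n a c) ⟩
    a ⊓ c               ≡⟨ m≥n⇒m⊓n≡n c≤a ⟩
    c                   ∎
    where open ≡-Reasoning

module Symmetries (m : ℕ) where

  open Cycle m

  mapV : (Fin n → Fin n) → Vertex n → Vertex n
  mapV f (outer a) = outer (f a)
  mapV f (inner a) = inner (f a)

  PreservesAdj : (Fin n → Fin n) → Set
  PreservesAdj f = ∀ {x y} → Adj n x y → Adj n (mapV f x) (mapV f y)

  preservesAdj : ∀ {f} → (∀ {s a b} → Neighbours s a b → Neighbours s (f a) (f b)) → PreservesAdj f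
  preservesAdj f-nb {outer a} {outer b} nb   = f-nb nb
  preservesAdj f-nb {outer a} {inner .a} refl = refl
  preservesAdj f-nb {inner a} {outer .a} refl = refl
  preservesAdj f-nb {inner a} {inner b} nb   = f-nb nb

  walk-map : ∀ {f} → PreservesAdj f → ∀ {x y p} → Walk n x y p → Walk n (mapV f x) (mapV f y) (map (mapV f) p)
  walk-map f-adj here       = here
  walk-map f-adj (step a w) = step (f-adj a) (walk-map f-adj w)

  mapV-inverse : ∀ {f g} → (∀ a → g (f a) ≡ a) → ∀ x → mapV g (mapV f x) ≡ x
  mapV-inverse g∘f (outer a) = cong outer (g∘f a)
  mapV-inverse g∘f (inner a) = cong inner (g∘f a)

  map-mapV-inverse : ∀ {f g} → (∀ a → g (f a) ≡ a) → ∀ p → map (mapV g) (map (mapV f) p) ≡ p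
  map-mapV-inverse {f} {g} g∘f p = begin
    map (mapV g) (map (mapV f) p)   ≡⟨ map-∘ p ⟨
    map (mapV g ∘ mapV f) p         ≡⟨ map-cong (mapV-inverse g∘f) p ⟩
    map (λ x → x) p                 ≡⟨ map-id p ⟩
    p                               ∎
    where open ≡-Reasoning

  mapV-injective : ∀ {f g} → (∀ a → g (f a) ≡ a) → ∀ {x y} → mapV f x ≡ mapV f y → x ≡ y
  mapV-injective {f} {g} g∘f {x} {y} e =
    trans (sym (mapV-inverse g∘f x)) (trans (cong (mapV g) e) (mapV-inverse g∘f y))

  map-mapV-injective : ∀ {f g} → (∀ a → g (f a) ≡ a) → ∀ {p q} → map (mapV f) p ≡ map (mapV f) q → p ≡ q
  map-mapV-injective {f} {g} g∘f {p} {q} e =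
    trans (sym (map-mapV-inverse g∘f p)) (trans (cong (map (mapV g)) e) (map-mapV-inverse g∘f q))

  record Automorphism : Set where
    field
      to from  : Fin n → Fin n
      from∘to  : ∀ a → from (to a) ≡ a
      to∘from  : ∀ a → to (from a) ≡ a
      to-adj   : PreservesAdj to
      from-adj : PreservesAdj from

  inverse : Automorphism → Automorphism
  inverse φ = record
    { to = from ; from = to ; from∘to = to∘from ; to∘from = from∘to ; to-adj = from-adj ; from-adj = to-adj }
    where open Automorphism φ

  geodesic-map : ∀ (φ : Automorphism) {x y p} → let open Automorphism φ in
    IsGeodesic n x y p → IsGeodesic n (mapV to x) (mapV to y) (map (mapV to) p)
  geodesic-map φ {x} {y} {p} ((w , u) , shortest) =
    (walk-map to-adj w , Unique.map⁺ (mapV-injective {g = from} from∘to) u) , shorter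
    where
    open Automorphism φ
    shorter : ∀ q → IsPath n (mapV to x) (mapV to y) q → length (map (mapV to) p) ≤ length q
    shorter q (wq , uq) = subst₂ _≤_ (sym (length-map (mapV to) p)) (length-map (mapV from) q)
      (shortest (map (mapV from) q)
        ( subst₂ (λ a b → Walk n a b (map (mapV from) q)) (mapV-inverse from∘to x) (mapV-inverse from∘to y)
            (walk-map from-adj wq)
        , Unique.map⁺ (mapV-injective {g = to} to∘from) uq))

  σ≡-map : ∀ (φ : Automorphism) {x y c} → let open Automorphism φ in
    σ≡ n x y c → σ≡ n (mapV to x) (mapV to y) c
  σ≡-map φ {x} {y} (L , unique , geodesics , refl) =
    map (map (mapV to)) L , Unique.map⁺ (map-mapV-injective {g = from} from∘to) unique ,
    (λ p → mk⇔ (⇒geodesic p) (geodesic⇒ p)) , length-map _ L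
    where
    open Automorphism φ
    ⇒geodesic : ∀ p → p ∈ map (map (mapV to)) L → IsGeodesic n (mapV to x) (mapV to y) p
    ⇒geodesic p p∈ with ∈-map⁻ (map (mapV to)) p∈
    ... | q , q∈L , refl = geodesic-map φ (Equivalence.to (geodesics q) q∈L)
    geodesic⇒ : ∀ p → IsGeodesic n (mapV to x) (mapV to y) p → p ∈ map (map (mapV to)) L
    geodesic⇒ p g = subst (_∈ map (map (mapV to)) L) (map-mapV-inverse to∘from p)
      (∈-map⁺ (map (mapV to)) (Equivalence.from (geodesics (map (mapV from) p))
        (subst₂ (λ a b → IsGeodesic n a b (map (mapV from) p)) (mapV-inverse from∘to x) (mapV-inverse from∘to y)
          (geodesic-map (inverse φ) g))))

  rot : ℕ → Fin n → Fin n
  rot c a = fin (c + toℕ a)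

  -- m ≡ -1 modulo n, so ref c is the reflection a ↦ c - a.
  ref : ℕ → Fin n → Fin n
  ref c a = fin (c + m * toℕ a)

  rot-shift : ∀ c {a b : Fin n} {s} → toℕ b ≡ (toℕ a + s) % n → toℕ (rot c b) ≡ (toℕ (rot c a) + s) % n
  rot-shift c {a} {b} {s} e = begin
    toℕ (rot c b)                 ≡⟨ toℕ-fin (c + toℕ b) ⟩
    (c + toℕ b) % n               ≡⟨ %-cong-+ˡ c (trans (cong (_% n) e) (m%n%n≡m%n (toℕ a + s) n)) ⟩
    (c + (toℕ a + s)) % n         ≡⟨ cong (_% n) (+-assoc c (toℕ a) s) ⟨
    (c + toℕ a + s) % n           ≡⟨ [x%n+y]%n≡[x+y]%n (c + toℕ a) s ⟨
    ((c + toℕ a) % n + s) % n     ≡⟨ cong (λ z → (z + s) % n) (toℕ-fin (c + toℕ a)) ⟨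
    (toℕ (rot c a) + s) % n       ∎
    where open ≡-Reasoning

  ref-shift : ∀ c {a b : Fin n} {s} → toℕ b ≡ (toℕ a + s) % n → toℕ (ref c a) ≡ (toℕ (ref c b) + s) % n
  ref-shift c {a} {b} {s} e = begin
    toℕ (ref c a)                       ≡⟨ toℕ-fin (c + m * toℕ a) ⟩
    (c + m * toℕ a) % n                 ≡⟨ [m+kn]%n≡m%n (c + m * toℕ a) s n ⟨
    (c + m * toℕ a + s * n) % n         ≡⟨ cong (_% n) (regroup m c (toℕ a) s) ⟩
    (c + s + m * (toℕ a + s)) % n       ≡⟨ %-cong-+ˡ (c + s) (%-cong-*ˡ m (trans (sym e) (sym (toℕ%n b)))) ⟩
    (c + s + m * toℕ b) % n             ≡⟨ cong (_% n) (swap m c (toℕ b) s) ⟩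
    (c + m * toℕ b + s) % n             ≡⟨ [x%n+y]%n≡[x+y]%n (c + m * toℕ b) s ⟨
    ((c + m * toℕ b) % n + s) % n       ≡⟨ cong (λ z → (z + s) % n) (toℕ-fin (c + m * toℕ b)) ⟨
    (toℕ (ref c b) + s) % n             ∎
    where
    open ≡-Reasoning
    regroup : ∀ m c a s → c + m * a + s * suc m ≡ c + s + m * (a + s)
    regroup = solve-∀
    swap : ∀ m c b s → c + s + m * b ≡ c + m * b + s
    swap = solve-∀

  rot-adj : ∀ c → PreservesAdj (rot c)
  rot-adj c = preservesAdj λ where
    (inj₁ e) → inj₁ (rot-shift c e)
    (inj₂ e) → inj₂ (rot-shift c e)

  ref-adj : ∀ c → PreservesAdj (ref c)
  ref-adj c = preservesAdj λ where
    (inj₁ e) → inj₂ (ref-shift c e)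
    (inj₂ e) → inj₁ (ref-shift c e)

  rot-inverse : ∀ {c c′} → c + c′ ≡ n → ∀ a → rot c′ (rot c a) ≡ a
  rot-inverse {c} {c′} c+c′≡n a = toℕ-injective (begin
    toℕ (rot c′ (rot c a))      ≡⟨ toℕ-fin (c′ + toℕ (rot c a)) ⟩
    (c′ + toℕ (rot c a)) % n    ≡⟨ %-cong-+ˡ c′ (toℕ-fin-% (c + toℕ a)) ⟩
    (c′ + (c + toℕ a)) % n      ≡⟨ cong (_% n) (regroup c c′ (toℕ a)) ⟩
    (toℕ a + (c + c′)) % n      ≡⟨ cong (λ z → (toℕ a + z) % n) c+c′≡n ⟩
    (toℕ a + n) % n             ≡⟨ [m+n]%n≡m%n (toℕ a) n ⟩
    toℕ a % n                   ≡⟨ toℕ%n a ⟩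
    toℕ a                       ∎)
    where
    open ≡-Reasoning
    regroup : ∀ c c′ a → c′ + (c + a) ≡ a + (c + c′)
    regroup = solve-∀

  ref-involutive : ∀ c a → ref c (ref c a) ≡ a
  ref-involutive c a = toℕ-injective (begin
    toℕ (ref c (ref c a))                              ≡⟨ toℕ-fin (c + m * toℕ (ref c a)) ⟩
    (c + m * toℕ (ref c a)) % n                        ≡⟨ %-cong-+ˡ c (%-cong-*ˡ m (toℕ-fin-% (c + m * toℕ a))) ⟩
    (c + m * (c + m * toℕ a)) % n                      ≡⟨ [m+kn]%n≡m%n (c + m * (c + m * toℕ a)) (2 * toℕ a) n ⟨
    (c + m * (c + m * toℕ a) + 2 * toℕ a * n) % n      ≡⟨ cong (_% n) (regroup m c (toℕ a)) ⟩
    (toℕ a + (c + toℕ a * n) * n) % n                  ≡⟨ [m+kn]%n≡m%n (toℕ a) (c + toℕ a * n) n ⟩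
    toℕ a % n                                          ≡⟨ toℕ%n a ⟩
    toℕ a                                              ∎)
    where
    open ≡-Reasoning
    regroup : ∀ m c a → c + m * (c + m * a) + 2 * a * suc m ≡ a + (c + a * suc m) * suc m
    regroup = solve-∀

  rotation : Fin n → Automorphism
  rotation j = record
    { to = rot (toℕ j) ; from = rot (n ∸ toℕ j)
    ; from∘to = rot-inverse {toℕ j} (m+[n∸m]≡n (<⇒≤ (toℕ<n j)))
    ; to∘from = rot-inverse {n ∸ toℕ j} (m∸n+n≡m (<⇒≤ (toℕ<n j)))
    ; to-adj = rot-adj (toℕ j) ; from-adj = rot-adj (n ∸ toℕ j) }

  reflection : ℕ → Automorphism
  reflection c = record
    { to = ref c ; from = ref c ; from∘to = ref-involutive c ; to∘from = ref-involutive c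
    ; to-adj = ref-adj c ; from-adj = ref-adj c }

  σ≡-relabel : ∀ {r c} (i j : Fin n) → r ≡ ∣ toℕ i - toℕ j ∣ →
    σ≡ n (outer (fin r)) (inner zero) c → σ≡ n (outer i) (inner j) c
  σ≡-relabel {r} {c} i j r≡ σ with toℕ j ≤? toℕ i
  ... | yes j≤i = subst₂ (λ a b → σ≡ n (outer a) (inner b) c) rot-r rot-0 (σ≡-map (rotation j) σ)
    where
    open ≡-Reasoning
    rot-r : rot (toℕ j) (fin r) ≡ i
    rot-r = toℕ-injective (begin
      toℕ (rot (toℕ j) (fin r))       ≡⟨ toℕ-fin (toℕ j + toℕ (fin r)) ⟩
      (toℕ j + toℕ (fin r)) % n       ≡⟨ %-cong-+ˡ (toℕ j) (toℕ-fin-% r) ⟩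
      (toℕ j + r) % n                 ≡⟨ cong (λ z → (toℕ j + z) % n) (trans r≡ (m≤n⇒∣n-m∣≡n∸m j≤i)) ⟩
      (toℕ j + (toℕ i ∸ toℕ j)) % n   ≡⟨ cong (_% n) (m+[n∸m]≡n j≤i) ⟩
      toℕ i % n                       ≡⟨ toℕ%n i ⟩
      toℕ i                           ∎)
    rot-0 : rot (toℕ j) zero ≡ j
    rot-0 = toℕ-injective (trans (toℕ-fin (toℕ j + 0)) (trans (cong (_% n) (+-identityʳ (toℕ j))) (toℕ%n j)))
  ... | no j≰i = subst₂ (λ a b → σ≡ n (outer a) (inner b) c) ref-r ref-0 (σ≡-map (reflection (toℕ j)) σ)
    where
    open ≡-Reasoning
    i≤j : toℕ i ≤ toℕ j
    i≤j = <⇒≤ (≰⇒> j≰i)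
    r≡j∸i : r ≡ toℕ j ∸ toℕ i
    r≡j∸i = trans r≡ (trans (∣-∣-comm (toℕ i) (toℕ j)) (m≤n⇒∣n-m∣≡n∸m i≤j))
    j≡i+r : toℕ j ≡ toℕ i + r
    j≡i+r = trans (sym (m+[n∸m]≡n i≤j)) (cong (toℕ i +_) (sym r≡j∸i))
    regroup : ∀ i r m → i + r + m * r ≡ i + r * suc m
    regroup = solve-∀
    ref-r : ref (toℕ j) (fin r) ≡ i
    ref-r = toℕ-injective (begin
      toℕ (ref (toℕ j) (fin r))         ≡⟨ toℕ-fin (toℕ j + m * toℕ (fin r)) ⟩
      (toℕ j + m * toℕ (fin r)) % n     ≡⟨ %-cong-+ˡ (toℕ j) (%-cong-*ˡ m (toℕ-fin-% r)) ⟩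
      (toℕ j + m * r) % n               ≡⟨ cong (λ z → (z + m * r) % n) j≡i+r ⟩
      (toℕ i + r + m * r) % n           ≡⟨ cong (_% n) (regroup (toℕ i) r m) ⟩
      (toℕ i + r * n) % n               ≡⟨ [m+kn]%n≡m%n (toℕ i) r n ⟩
      toℕ i % n                         ≡⟨ toℕ%n i ⟩
      toℕ i                             ∎)
    ref-0 : ref (toℕ j) zero ≡ j
    ref-0 = toℕ-injective (trans (toℕ-fin (toℕ j + m * 0))
      (trans (cong (λ z → (toℕ j + z) % n) (*-zeroʳ m)) (trans (cong (_% n) (+-identityʳ (toℕ j))) (toℕ%n j))))

module Potential (n : ℕ) .{{_ : NonZero n}} (pot : Vertex n → ℕ)
  (pot-adj : ∀ {x y} → Adj n x y → pot x ≤ suc (pot y)) (y₀ : Vertex n) (pot-y₀ : pot y₀ ≡ 0) where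

  Tight : Vertex n → List (Vertex n) → Set
  Tight x p = Walk n x y₀ p × length p ≤ suc (pot x)

  walk-length-lower : ∀ {x y p} → Walk n x y p → suc (pot x) ≤ pot y + length p
  walk-length-lower {x} here = ≤-reflexive (+-comm 1 (pot x))
  walk-length-lower {x} {y} (step {z = z} {p = p} adj w) = begin
    suc (pot x)               ≤⟨ s≤s (pot-adj adj) ⟩
    suc (suc (pot z))         ≤⟨ s≤s (walk-length-lower w) ⟩
    suc (pot y + length p)    ≡⟨ +-suc (pot y) (length p) ⟨
    pot y + suc (length p)    ∎
    where open ≤-Reasoning

  walk-to-y₀-length : ∀ {x p} → Walk n x y₀ p → suc (pot x) ≤ length p
  walk-to-y₀-length {x} {p} w = subst (λ z → suc (pot x) ≤ z + length p) pot-y₀ (walk-length-lower w)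

  tight-step : ∀ {x z p} → Adj n x z → Walk n z y₀ p → length (x ∷ p) ≤ suc (pot x) →
    suc (pot z) ≡ pot x × Tight z p
  tight-step {x} {z} adj w (s≤s len) = downhill , w , subst (_ ≤_) (sym downhill) len
    where
    downhill : suc (pot z) ≡ pot x
    downhill = ≤-antisym (≤-trans (walk-to-y₀-length w) len) (pot-adj adj)

  tight-below : ∀ {x p} → Tight x p → All (λ w → pot w ≤ pot x) p
  tight-below (here , _) = ≤-refl ∷ []
  tight-below (step adj w , len) with tight-step adj w len
  ... | downhill , tight =
    ≤-refl ∷ All.map (λ le → ≤-trans le (≤-trans (n≤1+n _) (≤-reflexive downhill))) (tight-below tight)

  tight-unique : ∀ {x p} → Tight x p → Unique p
  tight-unique (here , _) = [] ∷ []
  tight-unique {x} (step {z = z} adj w , len) with tight-step adj w len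
  ... | downhill , tight = All.map x≢ (tight-below tight) ∷ tight-unique tight
    where
    x≢ : ∀ {v} → pot v ≤ pot z → x ≢ v
    x≢ le refl = 1+n≰n (subst (_≤ pot z) (sym downhill) le)

  tight⇒geodesic : ∀ {x p} → Walk n x y₀ p → length p ≡ suc (pot x) → IsGeodesic n x y₀ p
  tight⇒geodesic w len = (w , tight-unique (w , ≤-reflexive len)) ,
    λ q (wq , _) → subst (_≤ length q) (sym len) (walk-to-y₀-length wq)

  σ≡-tight : ∀ {x} q qs → Unique (q ∷ qs) →
    All (λ p → Walk n x y₀ p × length p ≡ suc (pot x)) (q ∷ qs) →
    (∀ {p} → Tight x p → p ∈ q ∷ qs) → σ≡ n x y₀ (length (q ∷ qs))
  σ≡-tight {x} q qs unique exact complete = q ∷ qs , unique , (λ p → mk⇔ (⇒geodesic p) (geodesic⇒ p)) , refl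
    where
    ⇒geodesic : ∀ p → p ∈ q ∷ qs → IsGeodesic n x y₀ p
    ⇒geodesic p p∈ with All.lookup exact p∈
    ... | w , len = tight⇒geodesic w len
    geodesic⇒ : ∀ p → IsGeodesic n x y₀ p → p ∈ q ∷ qs
    geodesic⇒ p ((w , _) , shortest) with All.head exact
    ... | wq , len = complete (w , subst (length p ≤_) len (shortest q (wq , tight-unique (wq , ≤-reflexive len))))

module Geodesics (k : ℕ) (2≤k : 2 ≤ k) where

  open Cycle (2 * k)

  n≡ : n ≡ suc (k + k)
  n≡ = cong (λ z → suc (k + z)) (+-identityʳ k)

  double<n : ∀ {c} → c ≤ k → c + c < n
  double<n {c} c≤k = subst (c + c <_) (sym n≡) (s≤s (+-mono-≤ c≤k c≤k))

  double≤n : ∀ {c} → c ≤ k → c + c ≤ n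
  double≤n c≤k = <⇒≤ (double<n c≤k)

  +2<n : ∀ {c} → c ≤ k → c + 2 < n
  +2<n {c} c≤k = subst (c + 2 <_) (sym n≡) (s≤s (+-mono-≤ c≤k 2≤k))

  +1<n : ∀ {c} → c ≤ k → c + 1 < n
  +1<n {c} c≤k = <-trans (+-monoʳ-< c (n<1+n 1)) (+2<n c≤k)

  2≤n : 2 ≤ n
  2≤n = <⇒≤ (+2<n z≤n)

  1≤n : 1 ≤ n
  1≤n = ≤-trans (s≤s z≤n) 2≤n

  2≤double : ∀ t → 2 ≤ suc t + suc t
  2≤double t = s≤s (≤-trans (s≤s z≤n) (m≤n+m (suc t) t))

  -- A lower bound for the distance to v₀, exact at the outer vertices u_r with r ≤ k.
  pot : Vertex n → ℕ
  pot (outer a) = suc ⌈ cdist (toℕ a) /2⌉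
  pot (inner a) = ⌈ cdist (toℕ a) /2⌉

  ⌈/2⌉-lipschitz : ∀ {x y} → x ≤ y + 2 → ⌈ x /2⌉ ≤ suc ⌈ y /2⌉
  ⌈/2⌉-lipschitz {x} {y} le = ⌈n/2⌉-mono (subst (x ≤_) (+-comm y 2) le)

  pot-adj : ∀ {x y} → Adj n x y → pot x ≤ suc (pot y)
  pot-adj {outer a} {outer b} nb = s≤s (⌈/2⌉-lipschitz (≤-trans
    (cdist-lipschitz (<⇒≤ (toℕ<n b)) (step-cases 1≤n nb)) (+-monoʳ-≤ _ (n≤1+n 1))))
  pot-adj {outer a} {inner .a} refl = ≤-refl
  pot-adj {inner a} {outer .a} refl = ≤-trans (n≤1+n _) (n≤1+n _)
  pot-adj {inner a} {inner b} nb = ⌈/2⌉-lipschitz (cdist-lipschitz (<⇒≤ (toℕ<n b)) (step-cases 2≤n nb))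

  open Potential n pot pot-adj (inner zero) refl

  pot-inner-small : ∀ {a : Fin n} {c} → toℕ a ≡ c → c ≤ k → pot (inner a) ≡ ⌈ c /2⌉
  pot-inner-small refl c≤k = cong ⌈_/2⌉ (cdist-small (double≤n c≤k))

  pot-inner-even : ∀ t {a : Fin n} → toℕ a ≡ t + t → t + t ≤ k → pot (inner a) ≡ t
  pot-inner-even t e le = trans (pot-inner-small e le) (sym (n≡⌈n+n/2⌉ t))

  pot-inner-odd : ∀ t {a : Fin n} → toℕ a ≡ suc (t + t) → suc (t + t) ≤ k → pot (inner a) ≡ suc t
  pot-inner-odd t e le = trans (pot-inner-small e le) (cong suc (sym (n≡⌊n+n/2⌋ t)))

  pot-inner-far : ∀ t {a : Fin n} → toℕ a + (t + t) ≡ n → t + t ≤ k → pot (inner a) ≡ t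
  pot-inner-far t {a} e le = trans (cong ⌈_/2⌉ (cdist-large e (+-cancelʳ-≤ (t + t) (t + t) (toℕ a)
    (subst (t + t + (t + t) ≤_) (sym e) (double≤n le))))) (sym (n≡⌈n+n/2⌉ t))

  FarFromZero : ℕ → ℕ → Set
  FarFromZero t c = suc (t + t) ≤ c × suc (t + t) + c ≤ n

  pot-inner-lower : ∀ t {b : Fin n} → FarFromZero t (toℕ b) → suc t ≤ pot (inner b)
  pot-inner-lower t {b} (l≤b , l+b≤n) =
    subst (_≤ pot (inner b)) (cong suc (sym (n≡⌊n+n/2⌋ t))) (⌈n/2⌉-mono (cdist-lower l≤b l+b≤n))

  uphill : ∀ {x z} → pot x ≤ pot z → suc (pot z) ≢ pot x
  uphill {z = z} le d = 1+n≰n (subst (_≤ pot z) (sym d) le)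

  spoke-uphill : ∀ {a} → suc (pot (outer a)) ≢ pot (inner a)
  spoke-uphill {a} = uphill {inner a} {outer a} (n≤1+n _)

  no-descent : ∀ t {a b : Fin n} → pot (inner a) ≡ suc t → FarFromZero t (toℕ b) → suc (pot (inner b)) ≢ pot (inner a)
  no-descent t {a} {b} pa far = uphill {inner a} {inner b} (≤-trans (≤-reflexive pa) (pot-inner-lower t far))

  downhill-inner-even : ∀ t {a : Fin n} → toℕ a ≡ suc t + suc t → suc t + suc t ≤ k → ∀ {z} →
    Adj n (inner a) z → suc (pot z) ≡ pot (inner a) → Σ (Fin n) λ b → z ≡ inner b × toℕ b ≡ t + t
  downhill-inner-even t e le {outer _} refl d = ⊥-elim (spoke-uphill d)
  downhill-inner-even t {a} e le {inner b} nb d with step-cases 2≤n nb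
  ... | forward b≡ = ⊥-elim (no-descent t (pot-inner-even (suc t) e le) (far (trans b≡ (cong (_+ 2) e))) d)
    where
    far : ∀ {c} → c ≡ suc t + suc t + 2 → FarFromZero t c
    far refl = ≤-by 3 (lhs t) , subst (_< n) (rhs t) (double<n le)
      where
      lhs : ∀ t → suc (t + t) + 3 ≡ suc t + suc t + 2
      lhs = solve-∀
      rhs : ∀ t → (suc t + suc t) + (suc t + suc t) ≡ t + t + (suc t + suc t + 2)
      rhs = solve-∀
  ... | forward-wrap e′ = ⊥-elim (no-forward-wrap {toℕ a} {s = 2} (+2<n (subst (_≤ k) (sym e) le)) e′)
  ... | backward-wrap e′ = ⊥-elim (no-backward-wrap (toℕ<n b) (subst (2 ≤_) (sym e) (2≤double t)) e′)
  ... | backward e′ = b , refl , +-cancelʳ-≡ 2 (toℕ b) (t + t) (trans (sym e′) (trans e (double-suc t)))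
    where
    double-suc : ∀ t → suc t + suc t ≡ t + t + 2
    double-suc = solve-∀

  downhill-inner-odd : ∀ t {a : Fin n} → toℕ a ≡ suc (t + t) → suc (t + t) ≤ k → ∀ {z} →
    Adj n (inner a) z → suc (pot z) ≡ pot (inner a) →
    Σ (Fin n) λ b → z ≡ inner b × (toℕ b + 2 ≡ toℕ a ⊎ toℕ a ≡ k × toℕ b ≡ toℕ a + 2)
  downhill-inner-odd t e le {outer _} refl d = ⊥-elim (spoke-uphill d)
  downhill-inner-odd t {a} e le {inner b} nb d with step-cases 2≤n nb
  ... | backward e′ = b , refl , inj₁ (sym e′)
  ... | forward-wrap e′ = ⊥-elim (no-forward-wrap {toℕ a} {s = 2} (+2<n (subst (_≤ k) (sym e) le)) e′)
  ... | forward b≡ with m≤n⇒m<n∨m≡n le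
  ...   | inj₂ a≡k = b , refl , inj₂ (trans e a≡k , b≡)
  ...   | inj₁ a<k = ⊥-elim (no-descent t (pot-inner-odd t e le) (far (trans b≡ (cong (_+ 2) e))) d)
    where
    far : ∀ {c} → c ≡ suc (t + t) + 2 → FarFromZero t c
    far refl = ≤-by 2 refl , subst (_≤ n) (regroup t) (double≤n a<k)
      where
      regroup : ∀ t → suc (suc (t + t)) + suc (suc (t + t)) ≡ suc (t + t) + (suc (t + t) + 2)
      regroup = solve-∀
  downhill-inner-odd zero {a} e le {inner b} nb d | backward-wrap e′ =
    ⊥-elim (no-descent 0 (pot-inner-odd 0 e le) (1≤b , ≤-reflexive 1+b≡n) d)
    where
    1+b≡n : suc (toℕ b) ≡ n
    1+b≡n = sym (+-cancelʳ-≡ 1 n (suc (toℕ b)) (begin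
      n + 1             ≡⟨ +-comm n 1 ⟩
      1 + n             ≡⟨ cong (_+ n) e ⟨
      toℕ a + n         ≡⟨ e′ ⟩
      toℕ b + 2         ≡⟨ +-suc (toℕ b) 1 ⟩
      suc (toℕ b) + 1   ∎))
      where open ≡-Reasoning
    1≤b : 1 ≤ toℕ b
    1≤b = s≤s⁻¹ (subst (2 ≤_) (sym 1+b≡n) 2≤n)
  downhill-inner-odd (suc t) e le {inner b} nb d | backward-wrap e′ =
    ⊥-elim (no-backward-wrap (toℕ<n b) (subst (2 ≤_) (sym e) (≤-trans (2≤double t) (n≤1+n _))) e′)

  downhill-inner-far : ∀ t {a : Fin n} → toℕ a + (suc t + suc t) ≡ n → suc t + suc t < k → ∀ {z} →
    Adj n (inner a) z → suc (pot z) ≡ pot (inner a) →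
    Σ (Fin n) λ b → z ≡ inner b × (toℕ b ≡ toℕ a + 2 ⊎ toℕ b + n ≡ toℕ a + 2)
  downhill-inner-far t e lt {outer _} refl d = ⊥-elim (spoke-uphill d)
  downhill-inner-far t {a} e lt {inner b} nb d with step-cases 2≤n nb
  ... | forward e′ = b , refl , inj₁ e′
  ... | forward-wrap e′ = b , refl , inj₂ e′
  ... | backward e′ = ⊥-elim (no-descent t (pot-inner-far (suc t) e (<⇒≤ lt)) (l≤b , l+b≤n) d)
    where
    open ≤-Reasoning
    X : ℕ
    X = 2 + (suc t + suc t)
    b+X≡n : toℕ b + X ≡ n
    b+X≡n = trans (sym (+-assoc (toℕ b) 2 _)) (trans (cong (_+ (suc t + suc t)) (sym e′)) e)
    l+3≡X : ∀ t → suc (t + t) + 3 ≡ 2 + (suc t + suc t)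
    l+3≡X = solve-∀
    regroup : ∀ t → suc ((suc t + suc t) + (suc t + suc t)) ≡ suc (t + t) + (2 + (suc t + suc t))
    regroup = solve-∀
    l≤b : suc (t + t) ≤ toℕ b
    l≤b = +-cancelʳ-≤ X (suc (t + t)) (toℕ b) (begin
      suc (t + t) + X                          ≡⟨ regroup t ⟨
      suc ((suc t + suc t) + (suc t + suc t))  ≤⟨ double<n (<⇒≤ lt) ⟩
      n                                        ≡⟨ b+X≡n ⟨
      toℕ b + X                                ∎)
    l+b≤n : suc (t + t) + toℕ b ≤ n
    l+b≤n = begin
      suc (t + t) + toℕ b   ≤⟨ +-monoˡ-≤ (toℕ b) (≤-by 3 (l+3≡X t)) ⟩
      X + toℕ b             ≡⟨ +-comm X (toℕ b) ⟩
      toℕ b + X             ≡⟨ b+X≡n ⟩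
      n                     ∎
  ... | backward-wrap e′ = ⊥-elim (no-backward-wrap (toℕ<n b) 2≤a e′)
    where
    open ≤-Reasoning
    c : ℕ
    c = suc t + suc t
    2≤a : 2 ≤ toℕ a
    2≤a = +-cancelʳ-≤ c 2 (toℕ a) (begin
      2 + c       ≤⟨ +-monoˡ-≤ c (2≤double t) ⟩
      c + c       ≤⟨ double≤n (<⇒≤ lt) ⟩
      n           ≡⟨ e ⟨
      toℕ a + c   ∎)

  downhill-outer-even : ∀ t {a : Fin n} → toℕ a ≡ t + t → t + t ≤ k → ∀ {z} →
    Adj n (outer a) z → suc (pot z) ≡ pot (outer a) → z ≡ inner a
  downhill-outer-even t e le {inner _} refl d = refl
  downhill-outer-even zero e le {outer b} nb d =
    ⊥-elim (0≢1+n (sym (suc-injective (trans d (cong suc (pot-inner-even 0 e le))))))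
  downhill-outer-even (suc t) {a} e le {outer b} nb d with step-cases 1≤n nb
  ... | forward b≡ = ⊥-elim (no-descent t (pot-inner-even (suc t) e le) (far (trans b≡ (cong (_+ 1) e))) (suc-injective d))
    where
    far : ∀ {c} → c ≡ suc t + suc t + 1 → FarFromZero t c
    far refl = ≤-by 2 (l+2 t) , subst (_≤ n) (regroup t) (double≤n le)
      where
      l+2 : ∀ t → suc (t + t) + 2 ≡ suc t + suc t + 1
      l+2 = solve-∀
      regroup : ∀ t → (suc t + suc t) + (suc t + suc t) ≡ suc (t + t) + (suc t + suc t + 1)
      regroup = solve-∀
  ... | backward e′ = ⊥-elim (no-descent t (pot-inner-even (suc t) e le) (far b≡) (suc-injective d))
    where
    double-suc : ∀ t → suc t + suc t ≡ suc (t + t) + 1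
    double-suc = solve-∀
    b≡ : toℕ b ≡ suc (t + t)
    b≡ = +-cancelʳ-≡ 1 (toℕ b) (suc (t + t)) (trans (sym e′) (trans e (double-suc t)))
    far : ∀ {c} → c ≡ suc (t + t) → FarFromZero t c
    far refl = ≤-refl , double≤n (≤-trans (s≤s (+-monoʳ-≤ t (n≤1+n t))) le)
  ... | forward-wrap e′ = ⊥-elim (no-forward-wrap {toℕ a} {s = 1} (+1<n (subst (_≤ k) (sym e) le)) e′)
  ... | backward-wrap e′ = ⊥-elim (no-backward-wrap (toℕ<n b) (subst (1 ≤_) (sym e) (s≤s z≤n)) e′)

  downhill-outer-odd : ∀ t {a : Fin n} → toℕ a ≡ suc (t + t) → suc (t + t) ≤ k → ∀ {z} →
    Adj n (outer a) z → suc (pot z) ≡ pot (outer a) →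
    z ≡ inner a ⊎ Σ (Fin n) λ b → z ≡ outer b × toℕ b + 1 ≡ toℕ a
  downhill-outer-odd t e le {inner _} refl d = inj₁ refl
  downhill-outer-odd t {a} e le {outer b} nb d with step-cases 1≤n nb
  ... | backward e′ = inj₂ (b , refl , sym e′)
  ... | forward b≡ = ⊥-elim (no-descent t (pot-inner-odd t e le) (far (trans b≡ (cong (_+ 1) e))) (suc-injective d))
    where
    far : ∀ {c} → c ≡ suc (t + t) + 1 → FarFromZero t c
    far refl = ≤-by 1 refl , subst (_≤ n) (regroup t) (double<n le)
      where
      regroup : ∀ t → suc (suc (t + t) + suc (t + t)) ≡ suc (t + t) + (suc (t + t) + 1)
      regroup = solve-∀
  ... | forward-wrap e′ = ⊥-elim (no-forward-wrap {toℕ a} {s = 1} (+1<n (subst (_≤ k) (sym e) le)) e′)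
  ... | backward-wrap e′ = ⊥-elim (no-backward-wrap (toℕ<n b) (subst (1 ≤_) (sym e) (s≤s z≤n)) e′)

  k<n : k < n
  k<n = subst (k <_) (sym n≡) (s≤s (m≤m+n k k))

  down : ℕ → List (Vertex n)
  down zero    = inner zero ∷ []
  down (suc t) = inner (fin (suc t + suc t)) ∷ down t

  -- The case t = 0 is separate because fin n is zero only propositionally.
  upper : ℕ → Fin n
  upper zero    = zero
  upper (suc t) = fin (n ∸ (suc t + suc t))

  up : ℕ → List (Vertex n)
  up zero    = inner zero ∷ []
  up (suc t) = inner (upper (suc t)) ∷ up t

  tight-inner-even : ∀ t → t + t ≤ k → ∀ {a p} → toℕ a ≡ t + t → Tight (inner a) p → p ≡ down t
  tight-inner-even zero le e (here , _) = refl
  tight-inner-even zero le e (step adj w , len) =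
    ⊥-elim (0≢1+n (trans (sym (pot-inner-even 0 e le)) (sym (proj₁ (tight-step adj w len)))))
  tight-inner-even (suc t) le () (here , _)
  tight-inner-even (suc t) le e (step adj w , len) with tight-step adj w len
  ... | d , tight with downhill-inner-even t e le adj d
  ... | b , refl , b≡ = cong₂ _∷_ (cong inner (≡-fin e))
    (tight-inner-even t (≤-trans (+-mono-≤ (n≤1+n t) (n≤1+n t)) le) b≡ tight)

  tight-inner-far : ∀ t → suc t + suc t < k → ∀ {a p} → toℕ a + (suc t + suc t) ≡ n → Tight (inner a) p →
    p ≡ up (suc t)
  tight-inner-far t lt e (here , _) = ⊥-elim (<-irrefl e (<-trans lt k<n))
  tight-inner-far t lt e (step adj w , len) with tight-step adj w len
  ... | d , tight with downhill-inner-far t e lt adj d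
  tight-inner-far zero lt e (step adj w , len) | d , tight | b , refl , inj₁ b≡ =
    ⊥-elim (<-irrefl (trans b≡ e) (toℕ<n b))
  tight-inner-far zero lt {a} e (step adj w , len) | d , tight | b , refl , inj₂ b+n≡ =
    cong₂ _∷_ (cong inner (≡-fin (trans (sym (m+n∸n≡m (toℕ a) 2)) (cong (_∸ 2) e))))
      (tight-inner-even 0 z≤n (+-cancelʳ-≡ n (toℕ b) 0 (trans b+n≡ e)) tight)
  tight-inner-far (suc t) lt {a} e (step adj w , len) | d , tight | b , refl , inj₁ b≡ =
    cong₂ _∷_ (cong inner (≡-fin (trans (sym (m+n∸n≡m (toℕ a) c)) (cong (_∸ c) e))))
      (tight-inner-far t (≤-trans (s≤s (+-mono-≤ (n≤1+n (suc t)) (n≤1+n (suc t)))) lt)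
        (trans (cong (_+ _) b≡) (trans (regroup (toℕ a) t) e)) tight)
    where
    c : ℕ
    c = suc (suc t) + suc (suc t)
    regroup : ∀ a t → a + 2 + (suc t + suc t) ≡ a + (suc (suc t) + suc (suc t))
    regroup = solve-∀
  tight-inner-far (suc t) lt {a} e (step adj w , len) | d , tight | b , refl , inj₂ b+n≡ =
    ⊥-elim (no-forward-wrap {toℕ a} {s = 2}
      (subst (toℕ a + 2 <_) e (+-monoʳ-< (toℕ a) (≤-by (suc (t + t)) (3+ t)))) b+n≡)
    where
    3+ : ∀ t → 3 + suc (t + t) ≡ suc (suc t) + suc (suc t)
    3+ = solve-∀

  tight-inner-odd : ∀ t → suc (t + t) ≤ k → ∀ {a p} → toℕ a ≡ suc (t + t) → Tight (inner a) p →
    suc (t + t) ≡ k × p ≡ inner (fin (suc (t + t))) ∷ up t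
  tight-inner-odd t le () (here , _)
  tight-inner-odd t le e (step adj w , len) with tight-step adj w len
  ... | d , tight with downhill-inner-odd t e le adj d
  tight-inner-odd zero le e (step adj w , len) | d , tight | b , refl , inj₁ b+2≡a =
    ⊥-elim (1+n≰n (s≤s⁻¹ (subst (2 ≤_) (trans b+2≡a e) (m≤n+m 2 (toℕ b)))))
  tight-inner-odd (suc t) le e (step adj w , len) | d , tight | b , refl , inj₁ b+2≡a =
    ⊥-elim (1+n≰n (≤-trans (s≤s odd≤) (subst (_ ≤_) (sym t+t+1≡k) le)))
    where
    odd≤ : suc (t + t) ≤ suc t + suc t
    odd≤ = s≤s (+-monoʳ-≤ t (n≤1+n t))
    double-suc : ∀ t → suc (suc t + suc t) ≡ suc (t + t) + 2
    double-suc = solve-∀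
    b≡ : toℕ b ≡ suc (t + t)
    b≡ = +-cancelʳ-≡ 2 (toℕ b) (suc (t + t)) (trans b+2≡a (trans e (double-suc t)))
    t+t+1≡k : suc (t + t) ≡ k
    t+t+1≡k = proj₁ (tight-inner-odd t (≤-trans (≤-trans odd≤ (n≤1+n _)) le) b≡ tight)
  tight-inner-odd zero le e (step adj w , len) | d , tight | b , refl , inj₂ (a≡k , _) =
    ⊥-elim (1+n≰n (s≤s⁻¹ (subst (2 ≤_) (trans (sym a≡k) e) 2≤k)))
  tight-inner-odd (suc t) le e (step adj w , len) | d , tight | b , refl , inj₂ (a≡k , b≡) =
    trans (sym e) a≡k , cong₂ _∷_ (cong inner (≡-fin e))
      (tight-inner-far t (≤-reflexive (trans (sym e) a≡k)) b+c≡n tight)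
    where
    open ≡-Reasoning
    c : ℕ
    c = suc t + suc t
    regroup : ∀ t → suc (suc t + suc t) + 2 + (suc t + suc t) ≡ suc (suc (suc t + suc t) + suc (suc t + suc t))
    regroup = solve-∀
    b+c≡n : toℕ b + c ≡ n
    b+c≡n = begin
      toℕ b + c                   ≡⟨ cong (_+ c) (trans b≡ (cong (_+ 2) e)) ⟩
      suc c + 2 + c               ≡⟨ regroup t ⟩
      suc (suc c + suc c)         ≡⟨ cong (λ x → suc (x + x)) (trans (sym e) a≡k) ⟩
      suc (k + k)                 ≡⟨ n≡ ⟨
      n                           ∎

  spoke-then-down : ℕ → List (Vertex n)
  spoke-then-down t = outer (fin (t + t)) ∷ down t

  rim-then-down : ℕ → List (Vertex n)
  rim-then-down t = outer (fin (suc (t + t))) ∷ spoke-then-down t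

  spoke-then-up : ℕ → List (Vertex n)
  spoke-then-up t = outer (fin (suc (t + t))) ∷ inner (fin (suc (t + t))) ∷ up t

  tight-outer-even : ∀ t → t + t ≤ k → ∀ {a p} → toℕ a ≡ t + t → Tight (outer a) p → p ≡ spoke-then-down t
  tight-outer-even t le e (step adj w , len) with tight-step adj w len
  ... | d , tight with downhill-outer-even t e le adj d
  ... | refl = cong₂ _∷_ (cong outer (≡-fin e)) (tight-inner-even t le e tight)

  tight-outer-odd : ∀ t → suc (t + t) ≤ k → ∀ {a p} → toℕ a ≡ suc (t + t) → Tight (outer a) p →
    p ≡ rim-then-down t ⊎ suc (t + t) ≡ k × p ≡ spoke-then-up t
  tight-outer-odd t le e (step adj w , len) with tight-step adj w len
  ... | d , tight with downhill-outer-odd t e le adj d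
  ... | inj₁ refl with tight-inner-odd t le e tight
  ...   | t+t+1≡k , p≡ = inj₂ (t+t+1≡k , cong₂ _∷_ (cong outer (≡-fin e)) p≡)
  tight-outer-odd t le e (step adj w , len) | d , tight | inj₂ (b , refl , b+1≡a) =
    inj₁ (cong₂ _∷_ (cong outer (≡-fin e)) (tight-outer-even t (≤-trans (n≤1+n _) le) b≡ tight))
    where
    b≡ : toℕ b ≡ t + t
    b≡ = +-cancelʳ-≡ 1 (toℕ b) (t + t) (trans b+1≡a (trans e (+-comm 1 (t + t))))

  length-down : ∀ t → length (down t) ≡ suc t
  length-down zero    = refl
  length-down (suc t) = cong suc (length-down t)

  length-up : ∀ t → length (up t) ≡ suc t
  length-up zero    = refl
  length-up (suc t) = cong suc (length-up t)

  down-walk : ∀ t → Walk n (inner (fin (t + t))) (inner zero) (down t)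
  down-walk zero    = here
  down-walk (suc t) = step (inj₂ (trans (cong (toℕ ∘ fin) (double-suc t)) (toℕ-fin-+ (t + t) 2))) (down-walk t)
    where
    double-suc : ∀ t → suc t + suc t ≡ t + t + 2
    double-suc = solve-∀

  toℕ-upper : ∀ t → toℕ (upper t) ≡ (n ∸ (t + t)) % n
  toℕ-upper zero    = sym (n%n≡0 n)
  toℕ-upper (suc t) = toℕ-fin (n ∸ (suc t + suc t))

  up-walk : ∀ t → t + t ≤ n → Walk n (inner (upper t)) (inner zero) (up t)
  up-walk zero    _  = here
  up-walk (suc t) le = step (inj₁ adj) (up-walk t (≤-trans (+-mono-≤ (n≤1+n t) (n≤1+n t)) le))
    where
    open ≡-Reasoning
    c : ℕ
    c = suc t + suc t
    regroup : ∀ d t → d + 2 + (t + t) ≡ d + (suc t + suc t)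
    regroup = solve-∀
    shift : n ∸ c + 2 ≡ n ∸ (t + t)
    shift = begin
      n ∸ c + 2                        ≡⟨ m+n∸n≡m (n ∸ c + 2) (t + t) ⟨
      n ∸ c + 2 + (t + t) ∸ (t + t)    ≡⟨ cong (_∸ (t + t)) (trans (regroup (n ∸ c) t) (m∸n+n≡m le)) ⟩
      n ∸ (t + t)                      ∎
    adj : toℕ (upper t) ≡ (toℕ (upper (suc t)) + 2) % n
    adj = begin
      toℕ (upper t)                    ≡⟨ toℕ-upper t ⟩
      (n ∸ (t + t)) % n                ≡⟨ cong (_% n) shift ⟨
      (n ∸ c + 2) % n                  ≡⟨ toℕ-fin (n ∸ c + 2) ⟨
      toℕ (fin (n ∸ c + 2))            ≡⟨ toℕ-fin-+ (n ∸ c) 2 ⟩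
      (toℕ (upper (suc t)) + 2) % n    ∎

  pot-fin-even : ∀ t → t + t ≤ k → pot (inner (fin (t + t))) ≡ t
  pot-fin-even t le = pot-inner-even t (toℕ-fin< (≤-<-trans le k<n)) le

  pot-fin-odd : ∀ t → suc (t + t) ≤ k → pot (inner (fin (suc (t + t)))) ≡ suc t
  pot-fin-odd t le = pot-inner-odd t (toℕ-fin< (≤-<-trans le k<n)) le

  spoke-then-down-exact : ∀ t → t + t ≤ k →
    Walk n (outer (fin (t + t))) (inner zero) (spoke-then-down t) ×
    length (spoke-then-down t) ≡ suc (pot (outer (fin (t + t))))
  spoke-then-down-exact t le = step refl (down-walk t) , cong suc (trans (length-down t) (cong suc (sym (pot-fin-even t le))))

  rim-then-down-exact : ∀ t → suc (t + t) ≤ k →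
    Walk n (outer (fin (suc (t + t)))) (inner zero) (rim-then-down t) ×
    length (rim-then-down t) ≡ suc (pot (outer (fin (suc (t + t)))))
  rim-then-down-exact t le =
    step (inj₂ (trans (cong (toℕ ∘ fin) (+-comm 1 (t + t))) (toℕ-fin-+ (t + t) 1))) (proj₁ even) ,
    cong suc (trans (proj₂ even) (cong suc (trans (cong suc (pot-fin-even t t+t≤k)) (sym (pot-fin-odd t le)))))
    where
    t+t≤k : t + t ≤ k
    t+t≤k = ≤-trans (n≤1+n _) le
    even : Walk n (outer (fin (t + t))) (inner zero) (spoke-then-down t) ×
           length (spoke-then-down t) ≡ suc (pot (outer (fin (t + t))))
    even = spoke-then-down-exact t t+t≤k

  spoke-then-up-exact : ∀ t → suc (t + t) ≡ k →
    Walk n (outer (fin (suc (t + t)))) (inner zero) (spoke-then-up t) ×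
    length (spoke-then-up t) ≡ suc (pot (outer (fin (suc (t + t)))))
  spoke-then-up-exact zero 1≡k = ⊥-elim (1+n≰n (s≤s⁻¹ (subst (2 ≤_) (sym 1≡k) 2≤k)))
  spoke-then-up-exact (suc t) t+t+1≡k =
    step refl (step (inj₁ adj) (up-walk (suc t) (≤-trans (n≤1+n _) (≤-trans (≤-reflexive t+t+1≡k) (<⇒≤ k<n))))) ,
    cong (λ x → suc (suc x)) (trans (length-up (suc t)) (sym (pot-fin-odd (suc t) (≤-reflexive t+t+1≡k))))
    where
    open ≡-Reasoning
    c : ℕ
    c = suc t + suc t
    regroup : ∀ t → suc (suc (suc t + suc t) + suc (suc t + suc t)) ≡ suc (suc t + suc t) + 2 + (suc t + suc t)
    regroup = solve-∀
    n≡k+2+c : n ≡ suc c + 2 + c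
    n≡k+2+c = trans n≡ (trans (cong (λ x → suc (x + x)) (sym t+t+1≡k)) (regroup t))
    adj : toℕ (upper (suc t)) ≡ (toℕ (fin (suc c)) + 2) % n
    adj = begin
      toℕ (fin (n ∸ c))                ≡⟨ cong (λ x → toℕ (fin (x ∸ c))) n≡k+2+c ⟩
      toℕ (fin (suc c + 2 + c ∸ c))    ≡⟨ cong (toℕ ∘ fin) (m+n∸n≡m (suc c + 2) c) ⟩
      toℕ (fin (suc c + 2))            ≡⟨ toℕ-fin-+ (suc c) 2 ⟩
      (toℕ (fin (suc c)) + 2) % n      ∎

  σ-even : ∀ t → t + t ≤ k → σ≡ n (outer (fin (t + t))) (inner zero) 1
  σ-even t le = σ≡-tight (spoke-then-down t) [] ([] ∷ []) (spoke-then-down-exact t le ∷ [])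
    λ tight → here (tight-outer-even t le (toℕ-fin< (≤-<-trans le k<n)) tight)

  σ-odd-below : ∀ t → suc (t + t) < k → σ≡ n (outer (fin (suc (t + t)))) (inner zero) 1
  σ-odd-below t lt = σ≡-tight (rim-then-down t) [] ([] ∷ []) (rim-then-down-exact t (<⇒≤ lt) ∷ []) complete
    where
    complete : ∀ {p} → Tight (outer (fin (suc (t + t)))) p → p ∈ rim-then-down t ∷ []
    complete tight with tight-outer-odd t (<⇒≤ lt) (toℕ-fin< (<-trans lt k<n)) tight
    ... | inj₁ p≡ = here p≡
    ... | inj₂ (t+t+1≡k , _) = ⊥-elim (<-irrefl t+t+1≡k lt)

  σ-odd-k : ∀ t → suc (t + t) ≡ k → σ≡ n (outer (fin (suc (t + t)))) (inner zero) 2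
  σ-odd-k t t+t+1≡k = σ≡-tight (rim-then-down t) (spoke-then-up t ∷ []) (((λ ()) ∷ []) ∷ [] ∷ [])
    (rim-then-down-exact t (≤-reflexive t+t+1≡k) ∷ spoke-then-up-exact t t+t+1≡k ∷ []) complete
    where
    complete : ∀ {p} → Tight (outer (fin (suc (t + t)))) p → p ∈ rim-then-down t ∷ spoke-then-up t ∷ []
    complete tight with tight-outer-odd t (≤-reflexive t+t+1≡k) (toℕ-fin< (subst (_< n) (sym t+t+1≡k) k<n)) tight
    ... | inj₁ p≡ = here p≡
    ... | inj₂ (_ , p≡) = there (here p≡)

even-or-odd : ∀ r → ∃ λ t → r ≡ t + t ⊎ r ≡ suc (t + t)
even-or-odd zero = 0 , inj₁ refl
even-or-odd (suc r) with even-or-odd r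
... | t , inj₁ r≡ = t , inj₂ (cong suc r≡)
... | t , inj₂ r≡ = suc t , inj₁ (cong suc (trans r≡ (sym (+-suc t t))))

2∣double : ∀ t → 2 ∣ t + t
2∣double t = divides t (double t)
  where
  double : ∀ t → t + t ≡ t * 2
  double = solve-∀

¬2∣odd : ∀ t → ¬ 2 ∣ suc (t + t)
¬2∣odd t 2∣ = 1+n≰n (s≤s⁻¹ (∣⇒≤ (∣m+n∣m⇒∣n (subst (2 ∣_) (+-comm 1 (t + t)) 2∣) (2∣double t))))

mainTheorem5 : (k : ℕ) → 2 ≤ k → (i j : Fin (suc (2 * k))) →
    ∣ toℕ i - toℕ j ∣ ≤ k →
    ((∣ toℕ i - toℕ j ∣ < k → σ≡ (suc (2 * k)) (outer i) (inner j) 1)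
    × (∣ toℕ i - toℕ j ∣ ≡ k → 2 ∣ ∣ toℕ i - toℕ j ∣ → σ≡ (suc (2 * k)) (outer i) (inner j) 1)
    × (∣ toℕ i - toℕ j ∣ ≡ k → ¬ (2 ∣ ∣ toℕ i - toℕ j ∣) → σ≡ (suc (2 * k)) (outer i) (inner j) 2))
mainTheorem5 k 2≤k i j r≤k = below-k , even-k , odd-k
  where
  open Symmetries (2 * k) using (σ≡-relabel)
  open Geodesics k 2≤k using (σ-even; σ-odd-below; σ-odd-k)
  r : ℕ
  r = ∣ toℕ i - toℕ j ∣
  below-k : r < k → σ≡ (suc (2 * k)) (outer i) (inner j) 1
  below-k r<k with even-or-odd r
  ... | t , inj₁ r≡ = σ≡-relabel i j (sym r≡) (σ-even t (subst (_≤ k) r≡ r≤k))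
  ... | t , inj₂ r≡ = σ≡-relabel i j (sym r≡) (σ-odd-below t (subst (_< k) r≡ r<k))
  even-k : r ≡ k → 2 ∣ r → σ≡ (suc (2 * k)) (outer i) (inner j) 1
  even-k _ 2∣r with even-or-odd r
  ... | t , inj₁ r≡ = σ≡-relabel i j (sym r≡) (σ-even t (subst (_≤ k) r≡ r≤k))
  ... | t , inj₂ r≡ = ⊥-elim (¬2∣odd t (subst (2 ∣_) r≡ 2∣r))
  odd-k : r ≡ k → ¬ 2 ∣ r → σ≡ (suc (2 * k)) (outer i) (inner j) 2
  odd-k r≡k ¬2∣r with even-or-odd r
  ... | t , inj₁ r≡ = ⊥-elim (¬2∣r (subst (2 ∣_) (sym r≡) (2∣double t)))
  ... | t , inj₂ r≡ = σ≡-relabel i j (sym r≡) (σ-odd-k t (trans (sym r≡) r≡k))
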